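{- Let $(\mathcal{O},g,f)$ be an oriented matroid program of rank $r\ge3$ and let $C,X,Y$ be pairwise comodular cocircuits such that $z(C\circ X\circ Y)$ is a flat of rank $r-3$. Let $C_g=X_g=Y_g=+$. Let $e\in\mathrm{supp}(C)$ with $(X\circ Y)_e=0$. Let $X^1$ be the cocircuit obtained by cocircuit elimination of $g$ between $-X$ and $C$, and $Y^1$ the one obtained by elimination of $g$ between $-Y$ and $C$. Then $z(X^1\circ Y^1)$ is a flat of rank $r-2$ (i.e. $X^1\circ Y^1$ is an edge) and $$X\to_{g,f}Y\iff Y^1\to_{e,f}X^1\iff -X^1\to_{e,f}-Y^1.$$
   Context: $\mathcal{O}$ is an oriented matroid on $E$ of rank $r$ given by covectors in $\{+,-,0\}^E$; cocircuits are minimal nonzero covectors; $z(X)=\{e:X_e=0\}$, $\mathrm{supp}(X)=E\setminus z(X)$, $\mathrm{sep}(X,Y)=\{e:X_e=-Y_e\ne0\}$. Cocircuits $X\ne\pm Y$ are comodular if $z(X\circ Y)$ is a flat of rank $r-2$ in the underlying matroid; then for $e\in\mathrm{sep}(X,Y)$, cocircuit elimination of $e$ between $X$ and $Y$ yields the unique cocircuit $Z$ with $Z_e=0$, $\mathrm{supp}(Z)\subseteq\mathrm{supp}(X\circ Y)\setminus\{e\}$. For distinct $a,b\in E$ and comodular $X,Y$ with $X_a=Y_a\ne0$, let $Z$ be the elimination of $a$ between $-X$ and $Y$; $X\to_{a,b}Y$ means $Z_b=+$. An oriented matroid program $(\mathcal{O},g,f)$ has distinct $g,f$, $g$ not a loop,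 $f$ not a coloop. -}

module Defs where

open import Level using (0ℓ)
open import Data.Nat using (ℕ; suc; _≤_)
open import Data.Fin using (Fin; suc; inject₁; fromℕ)
open import Data.Product using (Σ; _×_; ∃)
open import Data.Sum using (_⊎_)
open import Data.Unit using (⊤)
open import Relation.Nullary using (¬_)
open import Relation.Unary using (Pred; _⊆_; _≐_)
open import Relation.Binary.PropositionalEquality using (_≡_; _≢_)

data Sign : Set where
  ⊕ ⊖ 𝟘 : Sign

SignVec : ℕ → Set
SignVec n = Fin n → Sign

negS : Sign → Sign
negS ⊕ = ⊖
negS ⊖ = ⊕
negS 𝟘 = 𝟘

compS : Sign → Sign → Sign
compS 𝟘 y = y
compS x y = x

module _ {n : ℕ} where

  zeroV : SignVec n
  zeroV _ = 𝟘

  -_ : SignVec n → SignVec n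
  (- X) e = negS (X e)

  _∘_ : SignVec n → SignVec n → SignVec n
  (X ∘ Y) e = compS (X e) (Y e)

  infix 4 _≗_
  _≗_ : SignVec n → SignVec n → Set
  X ≗ Y = ∀ e → X e ≡ Y e

  z : SignVec n → Pred (Fin n) 0ℓ
  z X e = X e ≡ 𝟘

  supp : SignVec n → Pred (Fin n) 0ℓ
  supp X e = X e ≢ 𝟘

  sep : SignVec n → SignVec n → Pred (Fin n) 0ℓ
  sep X Y e = (X e ≢ 𝟘) × (X e ≡ negS (Y e))

  _≼_ : SignVec n → SignVec n → Set
  Y ≼ X = ∀ e → (Y e ≡ 𝟘) ⊎ (Y e ≡ X e)

-- Oriented matroid on Fin n, given by its set of covectors
-- (covector axioms L0-L3 of Björner et al.)

record OrientedMatroid (n : ℕ) : Set₁ where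
  field
    L        : Pred (SignVec n) 0ℓ
    L-resp   : ∀ {X Y} → X ≗ Y → L X → L Y
    L0       : L zeroV
    L1       : ∀ {X} → L X → L (- X)
    L2       : ∀ {X Y} → L X → L Y → L (X ∘ Y)
    L3       : ∀ {X Y} → L X → L Y → ∀ e → sep X Y e →
               Σ (SignVec n) λ Z → L Z × (Z e ≡ 𝟘) ×
                 (∀ f → ¬ sep X Y f → Z f ≡ (X ∘ Y) f)

module _ {n : ℕ} (O : OrientedMatroid n) where
  open OrientedMatroid O

  Cocircuit : SignVec n → Set
  Cocircuit X = L X × ¬ (X ≗ zeroV) ×
                (∀ Y → L Y → Y ≼ X → (Y ≗ zeroV) ⊎ (Y ≗ X))

  -- Flats of the underlying matroid are exactly the zero sets of covectors.
  -- A chain of flats of length k ending at S: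
  --   z(c 0) ⊊ z(c 1) ⊊ ... ⊊ z(c k) = S  with all c i covectors.
  record FlatChain (S : Pred (Fin n) 0ℓ) (k : ℕ) : Set where
    field
      c      : Fin (suc k) → SignVec n
      cov    : ∀ i → L (c i)
      incl   : ∀ (i : Fin k) → z (c (inject₁ i)) ⊆ z (c (suc i))
      strict : ∀ (i : Fin k) → ¬ (z (c (suc i)) ⊆ z (c (inject₁ i)))
      top    : z (c (fromℕ k)) ≐ S

  FlatRank : Pred (Fin n) 0ℓ → ℕ → Set
  FlatRank S k = FlatChain S k × (∀ m → FlatChain S m → m ≤ k)

  HasRank : ℕ → Set
  HasRank r = FlatRank (λ _ → ⊤) r

  Comodular : ℕ → SignVec n → SignVec n → Set
  Comodular r X Y = Cocircuit X × Cocircuit Y × ¬ (X ≗ Y) × ¬ (X ≗ - Y) ×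
                    FlatRank (z (X ∘ Y)) (r Data.Nat.∸ 2)

  Elim : SignVec n → SignVec n → Fin n → SignVec n → Set
  Elim X Y e Z = Cocircuit Z × (Z e ≡ 𝟘) ×
                 (∀ f → Z f ≡ ⊕ → (X f ≡ ⊕) ⊎ (Y f ≡ ⊕)) ×
                 (∀ f → Z f ≡ ⊖ → (X f ≡ ⊖) ⊎ (Y f ≡ ⊖))

  Arrow : SignVec n → SignVec n → Fin n → Fin n → Set
  Arrow X Y a b = ∀ Z → Elim (- X) Y a Z → Z b ≡ ⊕

  Loop : Fin n → Set
  Loop e = ∀ X → L X → X e ≡ 𝟘

  Coloop : Fin n → Set
  Coloop e = ∃ λ X → Cocircuit X × (supp X ≐ (λ f → f ≡ e))

  Program : Fin n → Fin n → Set
  Program g f = (g ≢ f) × ¬ Loop g × ¬ Coloop f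

{-# OPTIONS --safe #-}
-- Everything happens in rank-2 intervals above the rank-(r-3) flat F = z(C∘X∘Y).
-- The rank-(r-2) flats z(X∘Y) and z(X¹∘Y¹) both contain F, the first also contains e and the
-- second g, and neither point lies in F.  A covector vanishing on a rank-(r-2) flat and on one
-- further point vanishes on the whole hyperplane they span, hence is ± the cocircuit of that
-- hyperplane.  So any elimination of g between -X and Y and any elimination of e between -Y¹
-- and X¹ vanish on z(X∘Y) ∪ z(X¹∘Y¹) and agree up to sign; the sign is fixed at a point h with
-- C_h = X_h = 0 ≠ Y_h (it exists because z(C∘X) ≠ F), where X¹_h = 0 and Y¹_h = -Y_h force
-- both to take the value Y_h.  The same h shows that z(X¹∘Y¹) lies strictly between F and the
-- hyperplane z(X¹), so it has rank r-2.  The last equivalence only uses that elimination is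
-- symmetric in its two arguments.
module Submission where

open import Defs
open import Data.Nat using (ℕ; _≤_; _∸_)
open import Data.Fin using (Fin)
open import Data.Product using (_×_)
open import Relation.Binary.PropositionalEquality using (_≡_; _≢_)
open import Function.Bundles using (_⇔_)

open import Level using (0ℓ)
open import Data.Bool.Properties using (T-≡)
open import Data.Empty using (⊥; ⊥-elim)
open import Data.Fin as Fin using (inject₁; fromℕ)
open import Data.Fin.Properties using (any?)
open import Data.Fin.Relation.Unary.Top using (view; ‵fromℕ; ‵inject₁; view-fromℕ; view-inject₁)
open import Data.Fin.Subset as Subset using (Subset; _⊂_)
open import Data.Fin.Subset.Induction using (⊂-wellFounded)
open import Data.Nat using (suc; _<_; s≤s)
open import Data.Nat.Properties using (≤-pred; 1+n≰n)
open import Data.Product using (Σ; ∃; _,_; proj₁; proj₂)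
open import Data.Sum as Sum using (_⊎_; inj₁; inj₂)
open import Data.Unit using (tt)
open import Data.Vec using (tabulate)
open import Data.Vec.Properties using (lookup∘tabulate; lookup⇒[]=; []=⇒lookup)
open import Function.Bundles using (mk⇔; module Equivalence)
open import Induction.WellFounded using (Acc; acc)
open import Relation.Binary.PropositionalEquality using (refl; sym; trans; cong)
open import Relation.Nullary using (¬_; Dec; yes; no; isYes; ¬?; contradiction)
open import Relation.Nullary.Decidable using (_×-dec_; decidable-stable; toWitness; fromWitness)
open import Relation.Unary using (Pred; Decidable; _⊆_; _≐_)

_≟ˢ_ : (x y : Sign) → Dec (x ≡ y)
⊕ ≟ˢ ⊕ = yes refl
⊖ ≟ˢ ⊖ = yes refl
𝟘 ≟ˢ 𝟘 = yes refl
⊕ ≟ˢ ⊖ = no λ ()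
⊕ ≟ˢ 𝟘 = no λ ()
⊖ ≟ˢ ⊕ = no λ ()
⊖ ≟ˢ 𝟘 = no λ ()
𝟘 ≟ˢ ⊕ = no λ ()
𝟘 ≟ˢ ⊖ = no λ ()

⊕⇒≢𝟘 : ∀ {x} → x ≡ ⊕ → x ≢ 𝟘
⊕⇒≢𝟘 refl ()

negS-involutive : ∀ x → negS (negS x) ≡ x
negS-involutive ⊕ = refl
negS-involutive ⊖ = refl
negS-involutive 𝟘 = refl

negS-≢𝟘 : ∀ {x} → x ≢ 𝟘 → negS x ≢ 𝟘
negS-≢𝟘 {⊕} _ ()
negS-≢𝟘 {⊖} _ ()
negS-≢𝟘 {𝟘} x≢𝟘 _ = x≢𝟘 refl

≢negS-self : ∀ {x} → x ≢ 𝟘 → x ≢ negS x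
≢negS-self {⊕} _ ()
≢negS-self {⊖} _ ()
≢negS-self {𝟘} x≢𝟘 _ = x≢𝟘 refl

≢negS : ∀ {w y} → y ≢ 𝟘 → w ≡ 𝟘 ⊎ w ≡ y → w ≢ negS y
≢negS y≢𝟘 (inj₁ refl) 𝟘≡-y = negS-≢𝟘 y≢𝟘 (sym 𝟘≡-y)
≢negS y≢𝟘 (inj₂ refl) = ≢negS-self y≢𝟘

≡±-of-≢𝟘 : ∀ {x v} → x ≢ 𝟘 → v ≢ 𝟘 → v ≡ x ⊎ v ≡ negS x
≡±-of-≢𝟘 {⊕} {⊕} _ _ = inj₁ refl
≡±-of-≢𝟘 {⊕} {⊖} _ _ = inj₂ refl
≡±-of-≢𝟘 {⊖} {⊕} _ _ = inj₂ refl
≡±-of-≢𝟘 {⊖} {⊖} _ _ = inj₁ refl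
≡±-of-≢𝟘 {𝟘} x≢𝟘 _ = ⊥-elim (x≢𝟘 refl)
≡±-of-≢𝟘 {_} {𝟘} _ v≢𝟘 = ⊥-elim (v≢𝟘 refl)

compS-≢𝟘 : ∀ {x} y → x ≢ 𝟘 → compS x y ≡ x
compS-≢𝟘 {⊕} _ _ = refl
compS-≢𝟘 {⊖} _ _ = refl
compS-≢𝟘 {𝟘} _ x≢𝟘 = ⊥-elim (x≢𝟘 refl)

compS-zero⁻ : ∀ {x y} → compS x y ≡ 𝟘 → x ≡ 𝟘 × y ≡ 𝟘
compS-zero⁻ {⊕} ()
compS-zero⁻ {⊖} ()
compS-zero⁻ {𝟘} y≡𝟘 = refl , y≡𝟘

compS-zero⁺ : ∀ {x y} → x ≡ 𝟘 → y ≡ 𝟘 → compS x y ≡ 𝟘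
compS-zero⁺ refl refl = refl

conformal-sign : ∀ {x v} → (x ≡ 𝟘 → v ≡ 𝟘) → ¬ (x ≢ 𝟘 × x ≡ negS v) → v ≡ 𝟘 ⊎ v ≡ x
conformal-sign {𝟘} x≡𝟘⇒v≡𝟘 _ = inj₁ (x≡𝟘⇒v≡𝟘 refl)
conformal-sign {⊕} {⊕} _ _ = inj₂ refl
conformal-sign {⊖} {⊖} _ _ = inj₂ refl
conformal-sign {⊕} {𝟘} _ _ = inj₁ refl
conformal-sign {⊖} {𝟘} _ _ = inj₁ refl
conformal-sign {⊕} {⊖} _ ¬sep = ⊥-elim (¬sep ((λ ()) , refl))
conformal-sign {⊖} {⊕} _ ¬sep = ⊥-elim (¬sep ((λ ()) , refl))

within-zeroʳ : ∀ {w x y} → (w ≡ ⊕ → x ≡ ⊕ ⊎ y ≡ ⊕) → (w ≡ ⊖ → x ≡ ⊖ ⊎ y ≡ ⊖) →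
               y ≡ 𝟘 → w ≡ 𝟘 ⊎ w ≡ x
within-zeroʳ {⊕} pos _ refl with pos refl
... | inj₁ x≡⊕ = inj₂ (sym x≡⊕)
... | inj₂ ()
within-zeroʳ {⊖} _ neg refl with neg refl
... | inj₁ x≡⊖ = inj₂ (sym x≡⊖)
... | inj₂ ()
within-zeroʳ {𝟘} _ _ _ = inj₁ refl

eliminant-⊕ : ∀ {x y w} → (¬ (x ≢ 𝟘 × x ≡ negS y) → w ≡ compS x y) → w ≡ ⊕ → x ≡ ⊕ ⊎ y ≡ ⊕
eliminant-⊕ {⊕} _ _ = inj₁ refl
eliminant-⊕ {⊖} {⊕} _ _ = inj₂ refl
eliminant-⊕ {⊖} {⊖} agree refl with agree (λ { (_ , ()) })
... | ()
eliminant-⊕ {⊖} {𝟘} agree refl with agree (λ { (_ , ()) })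
... | ()
eliminant-⊕ {𝟘} agree w≡⊕ = inj₂ (trans (sym (agree λ s → proj₁ s refl)) w≡⊕)

eliminant-⊖ : ∀ {x y w} → (¬ (x ≢ 𝟘 × x ≡ negS y) → w ≡ compS x y) → w ≡ ⊖ → x ≡ ⊖ ⊎ y ≡ ⊖
eliminant-⊖ {⊖} _ _ = inj₁ refl
eliminant-⊖ {⊕} {⊖} _ _ = inj₂ refl
eliminant-⊖ {⊕} {⊕} agree refl with agree (λ { (_ , ()) })
... | ()
eliminant-⊖ {⊕} {𝟘} agree refl with agree (λ { (_ , ()) })
... | ()
eliminant-⊖ {𝟘} agree w≡⊖ = inj₂ (trans (sym (agree λ s → proj₁ s refl)) w≡⊖)

module _ {n : ℕ} where

  z-∘⁻ : ∀ (X Y : SignVec n) {e} → z (X ∘ Y) e → z X e × z Y e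
  z-∘⁻ X Y {e} = compS-zero⁻ {X e}

  z-∘⁺ : ∀ {X Y : SignVec n} {e} → z X e → z Y e → z (X ∘ Y) e
  z-∘⁺ = compS-zero⁺

  z-neg : ∀ {X : SignVec n} {e} → z X e → z (- X) e
  z-neg = cong negS

  ±-zero : ∀ {V W : SignVec n} {b} → V ≗ W ⊎ V ≗ - W → z W b → z V b
  ±-zero (inj₁ V≗W) Wb = trans (V≗W _) Wb
  ±-zero (inj₂ V≗-W) Wb = trans (V≗-W _) (cong negS Wb)

  z⊆z-dichotomy : ∀ (X Y : SignVec n) → z X ⊆ z Y ⊎ ∃ λ a → z X a × Y a ≢ 𝟘
  z⊆z-dichotomy X Y with any? (λ a → (X a ≟ˢ 𝟘) ×-dec ¬? (Y a ≟ˢ 𝟘))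
  ... | yes escape = inj₂ escape
  ... | no ¬escape = inj₁ λ {a} Xa →
          decidable-stable (Y a ≟ˢ 𝟘) (λ Ya≢𝟘 → ¬escape (a , Xa , Ya≢𝟘))

  sep? : ∀ (X Y : SignVec n) → Decidable (sep X Y)
  sep? X Y e = ¬? (X e ≟ˢ 𝟘) ×-dec (X e ≟ˢ negS (Y e))

  sepSet : SignVec n → SignVec n → Subset n
  sepSet X Y = tabulate (λ e → isYes (sep? X Y e))

  ∈sepSet⁺ : ∀ {X Y : SignVec n} {e} → sep X Y e → e Subset.∈ sepSet X Y
  ∈sepSet⁺ {X} {Y} {e} s =
    lookup⇒[]= e _ (trans (lookup∘tabulate _ e)
                          (Equivalence.to T-≡ (fromWitness {a? = sep? X Y e} s)))

  ∈sepSet⁻ : ∀ {X Y : SignVec n} {e} → e Subset.∈ sepSet X Y → sep X Y e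
  ∈sepSet⁻ {X} {Y} {e} e∈ =
    toWitness {a? = sep? X Y e}
      (Equivalence.from T-≡ (trans (sym (lookup∘tabulate _ e)) ([]=⇒lookup e∈)))

  AgreesOffSep : SignVec n → SignVec n → SignVec n → Set
  AgreesOffSep X V Z = ∀ f → ¬ sep X V f → Z f ≡ (X ∘ V) f

  module _ {X V Z : SignVec n} (agree : AgreesOffSep X V Z) where

    agrees-zero : ∀ {f} → z X f → z V f → z Z f
    agrees-zero {f} Xf Vf = trans (agree f λ s → proj₁ s Xf) (z-∘⁺ {X = X} {V} Xf Vf)

    agrees-right : ∀ {f} → z X f → Z f ≡ V f
    agrees-right {f} Xf = trans (agree f λ s → proj₁ s Xf) (cong (λ x → compS x (V f)) Xf)

    agrees-left : ∀ {f} → X f ≢ 𝟘 → V f ≡ X f → Z f ≡ X f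
    agrees-left {f} Xf≢𝟘 Vf≡Xf =
      trans (agree f λ s → ≢negS-self Xf≢𝟘 (trans (proj₂ s) (cong negS Vf≡Xf))) (compS-≢𝟘 _ Xf≢𝟘)

    agrees-⊕ : ∀ {f} → Z f ≡ ⊕ → X f ≡ ⊕ ⊎ V f ≡ ⊕
    agrees-⊕ {f} = eliminant-⊕ (agree f)

    agrees-⊖ : ∀ {f} → Z f ≡ ⊖ → X f ≡ ⊖ ⊎ V f ≡ ⊖
    agrees-⊖ {f} = eliminant-⊖ (agree f)

    eliminant-shrinks : ∀ {i} → sep X V i → Z i ≡ 𝟘 → sepSet X Z ⊂ sepSet X V
    eliminant-shrinks {i} s Zi =
      (λ f∈ → ∈sepSet⁺ {X} {V} (sep-shrinks (∈sepSet⁻ {X} {Z} f∈))) , i , ∈sepSet⁺ {X} {V} s , i∉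
      where
      sep-shrinks : ∀ {f} → sep X Z f → sep X V f
      sep-shrinks {f} (Xf≢𝟘 , Xf≡-Zf) with sep? X V f
      ... | yes sepf = sepf
      ... | no ¬sepf = ⊥-elim (≢negS-self Xf≢𝟘
                         (trans Xf≡-Zf (cong negS (trans (agree f ¬sepf) (compS-≢𝟘 _ Xf≢𝟘)))))
      i∉ : ¬ (i Subset.∈ sepSet X Z)
      i∉ i∈ = let (Xi≢𝟘 , Xi≡-Zi) = ∈sepSet⁻ {X} {Z} i∈ in Xi≢𝟘 (trans Xi≡-Zi (cong negS Zi))

_∷ʳ_ : ∀ {A : Set} {k} → (Fin (suc k) → A) → A → Fin (suc (suc k)) → A
(c ∷ʳ v) i with view i
... | ‵fromℕ = v
... | ‵inject₁ j = c j

∷ʳ-fromℕ : ∀ {A : Set} {k} (c : Fin (suc k) → A) v → (c ∷ʳ v) (fromℕ (suc k)) ≡ v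
∷ʳ-fromℕ {k = k} c v rewrite view-fromℕ (suc k) = refl

∷ʳ-inject₁ : ∀ {A : Set} {k} (c : Fin (suc k) → A) v i → (c ∷ʳ v) (inject₁ i) ≡ c i
∷ʳ-inject₁ c v i rewrite view-inject₁ i = refl

module OrientedMatroidProperties {n : ℕ} (O : OrientedMatroid n) where
  open OrientedMatroid O

  FlatChain-resp : ∀ {S T k} → S ≐ T → FlatChain O S k → FlatChain O T k
  FlatChain-resp (S⊆T , T⊆S) ch = record
    { c = c ; cov = cov ; incl = incl ; strict = strict
    ; top = (λ x → S⊆T (proj₁ top x)) , (λ x → proj₂ top (T⊆S x)) }
    where open FlatChain ch

  extend : ∀ {S k V} → FlatChain O S k → L V → S ⊆ z V → ¬ (z V ⊆ S) → FlatChain O (z V) (suc k)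
  extend {S} {k} {V} ch LV S⊆V V⊈S = record
    { c = c ∷ʳ V ; cov = cov′ ; incl = incl′ ; strict = strict′ ; top = top′ }
    where
    open FlatChain ch
    cov′ : ∀ i → L ((c ∷ʳ V) i)
    cov′ i with view i
    ... | ‵fromℕ = LV
    ... | ‵inject₁ j = cov j
    incl′ : ∀ (i : Fin (suc k)) → z ((c ∷ʳ V) (inject₁ i)) ⊆ z ((c ∷ʳ V) (Fin.suc i))
    incl′ i with view i
    ... | ‵fromℕ rewrite ∷ʳ-inject₁ c V (fromℕ k) = λ x → S⊆V (proj₁ top x)
    ... | ‵inject₁ j rewrite ∷ʳ-inject₁ c V (inject₁ j) = incl j
    strict′ : ∀ (i : Fin (suc k)) → ¬ (z ((c ∷ʳ V) (Fin.suc i)) ⊆ z ((c ∷ʳ V) (inject₁ i)))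
    strict′ i with view i
    ... | ‵fromℕ rewrite ∷ʳ-inject₁ c V (fromℕ k) = λ V⊆c → V⊈S (λ x → proj₁ top (V⊆c x))
    ... | ‵inject₁ j rewrite ∷ʳ-inject₁ c V (inject₁ j) = strict j
    top′ : z ((c ∷ʳ V) (fromℕ (suc k))) ≐ z V
    top′ rewrite ∷ʳ-fromℕ c V = (λ x → x) , (λ x → x)

  chain<rank : ∀ {r k V} → HasRank O r → FlatChain O (z V) k → ¬ V ≗ zeroV → k < r
  chain<rank (_ , maximal) ch V≢0 =
    maximal _ (FlatChain-resp ((λ _ → tt) , (λ _ → refl))
                (extend ch L0 (λ _ → refl) (λ all → V≢0 (λ _ → all refl))))

  -- Otherwise S ⊊ z (V ∘ A) ⊊ z A would be a chain longer than the rank of z A allows.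
  covering : ∀ {S A V k e} → (∀ m → FlatChain O (z A) m → m ≤ suc k) → FlatChain O S k →
             L A → S ⊆ z A → L V → S ⊆ z V → z A e → z V e → ¬ S e → z A ⊆ z V
  covering {S} {A} {V} {k} bound ch LA S⊆A LV S⊆V Ae Ve e∉S with z⊆z-dichotomy A V
  ... | inj₁ A⊆V = A⊆V
  ... | inj₂ (a , Aa , Va≢𝟘) = contradiction (bound (suc (suc k)) (extend below LA ⊆A ⊉a)) 1+n≰n
    where
    below : FlatChain O (z (V ∘ A)) (suc k)
    below = extend ch (L2 LV LA) (λ x → z-∘⁺ {X = V} {A} (S⊆V x) (S⊆A x))
                      (λ V∘A⊆S → e∉S (V∘A⊆S (z-∘⁺ {X = V} {A} Ve Ae)))
    ⊆A : z (V ∘ A) ⊆ z A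
    ⊆A q = proj₂ (z-∘⁻ V A q)
    ⊉a : ¬ (z A ⊆ z (V ∘ A))
    ⊉a A⊆V∘A = Va≢𝟘 (proj₁ (z-∘⁻ V A (A⊆V∘A Aa)))

  -- Induction on sep(X, V): eliminating a separating element i between X and V gives a covector
  -- with the same hypotheses and a smaller separation set, which would then equal X although
  -- it vanishes at i.
  agree⇒≗ : ∀ {X V j} → Cocircuit O X → L V → z X ⊆ z V → X j ≢ 𝟘 → V j ≡ X j → V ≗ X
  agree⇒≗ {X} {V} {j} (LX , _ , minimal) LV X⊆V Xj≢𝟘 = go (⊂-wellFounded (sepSet X V)) LV X⊆V
    where
    go : ∀ {V} → Acc _⊂_ (sepSet X V) → L V → z X ⊆ z V → V j ≡ X j → V ≗ X
    go {V} (acc smaller) LV X⊆V Vj with any? (sep? X V)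
    ... | yes (i , s) = ⊥-elim (eliminate (L3 LX LV i s))
      where
      eliminate : Σ (SignVec n) (λ Z → L Z × Z i ≡ 𝟘 × AgreesOffSep X V Z) → ⊥
      eliminate (Z , LZ , Zi , agree) = proj₁ s (trans (sym (Z≗X i)) Zi)
        where
        Z≗X : Z ≗ X
        Z≗X = go (smaller (eliminant-shrinks agree s Zi)) LZ
                 (λ Xx → agrees-zero agree Xx (X⊆V Xx)) (agrees-left agree Xj≢𝟘 Vj)
    ... | no ¬sep with minimal V LV (λ x → conformal-sign (X⊆V {x}) (λ s → ¬sep (x , s)))
    ...   | inj₁ V≗0 = ⊥-elim (Xj≢𝟘 (trans (sym Vj) (V≗0 j)))
    ...   | inj₂ V≗X = V≗X

  cocircuit-determined : ∀ {X V b} → Cocircuit O X → L V → z X ⊆ z V → V b ≢ 𝟘 → V ≗ X ⊎ V ≗ - X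
  cocircuit-determined {X} {V} {b} cX LV X⊆V Vb≢𝟘 = by-sign (≡±-of-≢𝟘 Xb≢𝟘 Vb≢𝟘)
    where
    Xb≢𝟘 : X b ≢ 𝟘
    Xb≢𝟘 Xb = Vb≢𝟘 (X⊆V Xb)
    by-sign : V b ≡ X b ⊎ V b ≡ negS (X b) → V ≗ X ⊎ V ≗ - X
    by-sign (inj₁ Vb≡Xb) = inj₁ (agree⇒≗ cX LV X⊆V Xb≢𝟘 Vb≡Xb)
    by-sign (inj₂ Vb≡-Xb) = inj₂ λ f → trans (sym (negS-involutive (V f))) (cong negS (-V≗X f))
      where
      -V≗X : (- V) ≗ X
      -V≗X = agree⇒≗ cX (L1 LV) (λ Xx → z-neg {X = V} (X⊆V Xx)) Xb≢𝟘
               (trans (cong negS Vb≡-Xb) (negS-involutive (X b)))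

  hyperplane-unique : ∀ {k G W V e b} → HasRank O (suc (suc k)) → FlatChain O G k →
    Cocircuit O W → L V → G ⊆ z W → G ⊆ z V → z W e → z V e → ¬ G e → V b ≢ 𝟘 →
    V ≗ W ⊎ V ≗ - W
  hyperplane-unique {k} {W = W} hr ch cW@(LW , W≢0 , _) LV G⊆W G⊆V We Ve e∉G Vb≢𝟘 =
    cocircuit-determined cW LV (covering bound ch LW G⊆W LV G⊆V We Ve e∉G) Vb≢𝟘
    where
    bound : ∀ m → FlatChain O (z W) m → m ≤ suc k
    bound m chain = ≤-pred (chain<rank hr chain W≢0)

  hyperplanes-meet-in : ∀ {k G W V b p} → HasRank O (suc (suc k)) → FlatChain O G k →
    Cocircuit O W → L V → G ⊆ z W → G ⊆ z V → W b ≡ 𝟘 → V b ≢ 𝟘 → z V p → ¬ G p → W p ≢ 𝟘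
  hyperplanes-meet-in hr ch cW LV G⊆W G⊆V Wb Vb≢𝟘 Vp p∉G Wp =
    Vb≢𝟘 (±-zero (hyperplane-unique hr ch cW LV G⊆W G⊆V Wp Vp p∉G Vb≢𝟘) Wb)

  Elim-comm : ∀ {A B a Z} → Elim O A B a Z → Elim O B A a Z
  Elim-comm (cZ , Za , pos , neg) =
    cZ , Za , (λ f p → Sum.swap (pos f p)) , (λ f p → Sum.swap (neg f p))

  Elim-resp : ∀ {A A′ B B′ a Z} → A ≗ A′ → B ≗ B′ → Elim O A B a Z → Elim O A′ B′ a Z
  Elim-resp A≗A′ B≗B′ (cZ , Za , pos , neg) =
    cZ , Za , (λ f p → Sum.map (trans (sym (A≗A′ f))) (trans (sym (B≗B′ f))) (pos f p))
            , (λ f p → Sum.map (trans (sym (A≗A′ f))) (trans (sym (B≗B′ f))) (neg f p))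

  Elim-zeroʳ : ∀ {A B a Z f} → Elim O A B a Z → z B f → Z f ≡ 𝟘 ⊎ Z f ≡ A f
  Elim-zeroʳ {f = f} (_ , _ , pos , neg) = within-zeroʳ (pos f) (neg f)

  Elim-zeroˡ : ∀ {A B a Z f} → Elim O A B a Z → z A f → Z f ≡ 𝟘 ⊎ Z f ≡ B f
  Elim-zeroˡ el = Elim-zeroʳ (Elim-comm el)

  Elim-zero : ∀ {A B a Z f} → Elim O A B a Z → z A f → z B f → z Z f
  Elim-zero el Af Bf with Elim-zeroʳ el Bf
  ... | inj₁ Zf = Zf
  ... | inj₂ Zf≡Af = trans Zf≡Af Af

  -- Z and the eliminant Z₀ given by L3 both vanish on G and at a, so Z₀ = ±Z; the test point h,
  -- where Z₀ takes the value B h, excludes the minus sign.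
  Elim-unique : ∀ {k G A B a Z h} → HasRank O (suc (suc k)) → FlatChain O G k →
    L A → L B → sep A B a → G ⊆ z A → G ⊆ z B →
    Cocircuit O Z → Z a ≡ 𝟘 → G ⊆ z Z →
    A h ≡ 𝟘 → B h ≢ 𝟘 → Z h ≢ negS (B h) → Elim O A B a Z
  Elim-unique {G = G} {A} {B} {a} {Z} {h} hr ch LA LB s G⊆A G⊆B cZ Za G⊆Z Ah Bh≢𝟘 Zh≢-Bh =
    compare (L3 LA LB a s)
    where
    compare : Σ (SignVec n) (λ Z₀ → L Z₀ × Z₀ a ≡ 𝟘 × AgreesOffSep A B Z₀) → Elim O A B a Z
    compare (Z₀ , LZ₀ , Z₀a , agree) =
      by-sign (hyperplane-unique hr ch cZ LZ₀ G⊆Z G⊆Z₀ Za Z₀a a∉G Z₀h≢𝟘)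
      where
      G⊆Z₀ : G ⊆ z Z₀
      G⊆Z₀ Gx = agrees-zero agree (G⊆A Gx) (G⊆B Gx)
      a∉G : ¬ G a
      a∉G Ga = proj₁ s (G⊆A Ga)
      Z₀h≡Bh : Z₀ h ≡ B h
      Z₀h≡Bh = agrees-right agree Ah
      Z₀h≢𝟘 : Z₀ h ≢ 𝟘
      Z₀h≢𝟘 Z₀h = Bh≢𝟘 (trans (sym Z₀h≡Bh) Z₀h)
      by-sign : Z₀ ≗ Z ⊎ Z₀ ≗ - Z → Elim O A B a Z
      by-sign (inj₁ Z₀≗Z) = cZ , Za , (λ f Zf → agrees-⊕ agree (trans (Z₀≗Z f) Zf))
                                   , (λ f Zf → agrees-⊖ agree (trans (Z₀≗Z f) Zf))
      by-sign (inj₂ Z₀≗-Z) = ⊥-elim (Zh≢-Bh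
        (trans (sym (negS-involutive (Z h))) (cong negS (trans (sym (Z₀≗-Z h)) Z₀h≡Bh))))

  Arrow-cong : ∀ {A B a A′ B′ a′ b} → (∀ Z → Elim O (- A) B a Z ⇔ Elim O (- A′) B′ a′ Z) →
               Arrow O A B a b ⇔ Arrow O A′ B′ a′ b
  Arrow-cong same = mk⇔ (λ arrow Z el → arrow Z (Equivalence.from (same Z) el))
                        (λ arrow Z el → arrow Z (Equivalence.to (same Z) el))

  Arrow-neg : ∀ {A B a b} → Arrow O A B a b ⇔ Arrow O (- B) (- A) a b
  Arrow-neg {A} {B} = Arrow-cong λ Z →
    mk⇔ (λ el → Elim-resp (λ f → sym (negS-involutive (B f))) (λ _ → refl) (Elim-comm el))
        (λ el → Elim-comm (Elim-resp (λ f → negS-involutive (B f)) (λ _ → refl) el))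

-- Here r is the rank of F, i.e. the rank of the oriented matroid minus 3.
module ComodularTriple {n : ℕ} (O : OrientedMatroid n)
  {r : ℕ} (hr : HasRank O (suc (suc (suc r))))
  {g e : Fin n} {C X Y X¹ Y¹ : SignVec n}
  (LC : OrientedMatroid.L O C) (LX : OrientedMatroid.L O X) (LY : OrientedMatroid.L O Y)
  (C∘X-chain : FlatChain O (z (C ∘ X)) (suc r)) (C∘Y-chain : FlatChain O (z (C ∘ Y)) (suc r))
  (X∘Y-rank : FlatRank O (z (X ∘ Y)) (suc r)) (F-rank : FlatRank O (z (C ∘ (X ∘ Y))) r)
  (Cg : C g ≡ ⊕) (Xg : X g ≡ ⊕) (Yg : Y g ≡ ⊕) (Ce≢𝟘 : C e ≢ 𝟘) (XYe : (X ∘ Y) e ≡ 𝟘)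
  (elimX : Elim O (- X) C g X¹) (elimY : Elim O (- Y) C g Y¹) where
  open OrientedMatroid O
  open OrientedMatroidProperties O

  F : Pred (Fin n) 0ℓ
  F = z (C ∘ (X ∘ Y))

  F-zeros : ∀ {x} → F x → C x ≡ 𝟘 × X x ≡ 𝟘 × Y x ≡ 𝟘
  F-zeros Fx = let (Cx , XYx) = z-∘⁻ C (X ∘ Y) Fx in Cx , z-∘⁻ X Y XYx

  Xe : X e ≡ 𝟘
  Xe = proj₁ (z-∘⁻ X Y XYe)

  Ye : Y e ≡ 𝟘
  Ye = proj₂ (z-∘⁻ X Y XYe)

  g∉F : ¬ F g
  g∉F Fg = ⊕⇒≢𝟘 Cg (proj₁ (F-zeros Fg))

  e∉F : ¬ F e
  e∉F Fe = Ce≢𝟘 (proj₁ (F-zeros Fe))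

  cX¹ : Cocircuit O X¹
  cX¹ = proj₁ elimX

  cY¹ : Cocircuit O Y¹
  cY¹ = proj₁ elimY

  X¹g : X¹ g ≡ 𝟘
  X¹g = proj₁ (proj₂ elimX)

  Y¹g : Y¹ g ≡ 𝟘
  Y¹g = proj₁ (proj₂ elimY)

  C∘A⊆A¹ : ∀ {A A¹} → Elim O (- A) C g A¹ → z (C ∘ A) ⊆ z A¹
  C∘A⊆A¹ {A} el q = let (Cx , Ax) = z-∘⁻ C A q in Elim-zero el (z-neg {X = A} Ax) Cx

  F⊆X¹ : F ⊆ z X¹
  F⊆X¹ Fx = let (Cx , Xx , _) = F-zeros Fx in Elim-zero elimX (z-neg {X = X} Xx) Cx

  F⊆Y¹ : F ⊆ z Y¹
  F⊆Y¹ Fx = let (Cx , _ , Yx) = F-zeros Fx in Elim-zero elimY (z-neg {X = Y} Yx) Cx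

  F⊆X¹∘Y¹ : F ⊆ z (X¹ ∘ Y¹)
  F⊆X¹∘Y¹ Fx = z-∘⁺ {X = X¹} {Y¹} (F⊆X¹ Fx) (F⊆Y¹ Fx)

  C∘X⊈Y : ∃ λ h → z (C ∘ X) h × Y h ≢ 𝟘
  C∘X⊈Y with z⊆z-dichotomy (C ∘ X) Y
  ... | inj₂ found = found
  ... | inj₁ C∘X⊆Y =
    contradiction (proj₂ F-rank (suc r) (FlatChain-resp (C∘X⊆F , F⊆C∘X) C∘X-chain)) 1+n≰n
    where
    C∘X⊆F : z (C ∘ X) ⊆ F
    C∘X⊆F q = let (Cx , Xx) = z-∘⁻ C X q in
      z-∘⁺ {X = C} {X ∘ Y} Cx (z-∘⁺ {X = X} {Y} Xx (C∘X⊆Y q))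
    F⊆C∘X : F ⊆ z (C ∘ X)
    F⊆C∘X Fx = let (Cx , Xx , _) = F-zeros Fx in z-∘⁺ {X = C} {X} Cx Xx

  h : Fin n
  h = proj₁ C∘X⊈Y

  Ch : C h ≡ 𝟘
  Ch = proj₁ (z-∘⁻ C X (proj₁ (proj₂ C∘X⊈Y)))

  Xh : X h ≡ 𝟘
  Xh = proj₂ (z-∘⁻ C X (proj₁ (proj₂ C∘X⊈Y)))

  Yh≢𝟘 : Y h ≢ 𝟘
  Yh≢𝟘 = proj₂ (proj₂ C∘X⊈Y)

  X¹h : X¹ h ≡ 𝟘
  X¹h = Elim-zero elimX (z-neg {X = X} Xh) Ch

  Y¹h : Y¹ h ≡ negS (Y h)
  Y¹h with Elim-zeroʳ elimY Ch
  ... | inj₂ Y¹h≡-Yh = Y¹h≡-Yh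
  ... | inj₁ Y¹h≡𝟘 = ⊥-elim (hyperplanes-meet-in hr C∘Y-chain cY¹ LC (C∘A⊆A¹ elimY)
                       (λ q → proj₁ (z-∘⁻ C Y q)) Y¹g (⊕⇒≢𝟘 Cg) Ch
                       (λ q → Yh≢𝟘 (proj₂ (z-∘⁻ C Y q))) Y¹h≡𝟘)

  Y¹h≢𝟘 : Y¹ h ≢ 𝟘
  Y¹h≢𝟘 Y¹h≡𝟘 = negS-≢𝟘 Yh≢𝟘 (trans (sym Y¹h) Y¹h≡𝟘)

  value-at-e : ∀ {A A¹} → L A → FlatChain O (z (C ∘ A)) (suc r) → A g ≡ ⊕ → A e ≡ 𝟘 →
               Elim O (- A) C g A¹ → A¹ e ≡ C e
  value-at-e {A} LA chain Ag Ae el with Elim-zeroˡ el (z-neg {X = A} Ae)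
  ... | inj₂ A¹e≡Ce = A¹e≡Ce
  ... | inj₁ A¹e≡𝟘 = ⊥-elim (hyperplanes-meet-in hr chain (proj₁ el) LA (C∘A⊆A¹ el)
                       (λ q → proj₂ (z-∘⁻ C A q)) (proj₁ (proj₂ el)) (⊕⇒≢𝟘 Ag) Ae
                       (λ q → Ce≢𝟘 (proj₁ (z-∘⁻ C A q))) A¹e≡𝟘)

  X¹e : X¹ e ≡ C e
  X¹e = value-at-e LX C∘X-chain Xg Xe elimX

  Y¹e : Y¹ e ≡ C e
  Y¹e = value-at-e LY C∘Y-chain Yg Ye elimY

  X¹∘Y¹-rank : FlatRank O (z (X¹ ∘ Y¹)) (suc r)
  X¹∘Y¹-rank = extend (proj₁ F-rank) (L2 (proj₁ cX¹) (proj₁ cY¹)) F⊆X¹∘Y¹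
                 (λ X¹∘Y¹⊆F → g∉F (X¹∘Y¹⊆F (z-∘⁺ {X = X¹} {Y¹} X¹g Y¹g)))
             , bound
    where
    bound : ∀ m → FlatChain O (z (X¹ ∘ Y¹)) m → m ≤ suc r
    bound m chain = ≤-pred (≤-pred (chain<rank hr
      (extend chain (proj₁ cX¹) (λ q → proj₁ (z-∘⁻ X¹ Y¹ q))
              (λ X¹⊆X¹∘Y¹ → Y¹h≢𝟘 (proj₂ (z-∘⁻ X¹ Y¹ (X¹⊆X¹∘Y¹ X¹h)))))
      (proj₁ (proj₂ cX¹))))

  elim⇒ : ∀ {W} → Elim O (- Y¹) X¹ e W → Elim O (- X) Y g W
  elim⇒ {W} el@(cW , We , _) =
    Elim-unique hr (proj₁ X∘Y-rank) (L1 LX) LY sep-g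
      (λ q → z-neg {X = X} (proj₁ (z-∘⁻ X Y q))) (λ q → proj₂ (z-∘⁻ X Y q))
      cW Wg X∘Y⊆W (z-neg {X = X} Xh) Yh≢𝟘 Wh≢-Yh
    where
    sep-g : sep (- X) Y g
    sep-g = negS-≢𝟘 (⊕⇒≢𝟘 Xg) , cong negS (trans Xg (sym Yg))
    Wg : W g ≡ 𝟘
    Wg = Elim-zero el (z-neg {X = Y¹} Y¹g) X¹g
    X∘Y⊆W : z (X ∘ Y) ⊆ z W
    X∘Y⊆W = covering (proj₂ X∘Y-rank) (proj₁ F-rank) (L2 LX LY)
              (λ Fx → proj₂ (z-∘⁻ C (X ∘ Y) Fx))
              (proj₁ cW) (λ Fx → Elim-zero el (z-neg {X = Y¹} (F⊆Y¹ Fx)) (F⊆X¹ Fx))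
              XYe We e∉F
    Wh≢-Yh : W h ≢ negS (Y h)
    Wh≢-Yh = ≢negS Yh≢𝟘
      (Sum.map₂ (λ Wh → trans Wh (trans (cong negS Y¹h) (negS-involutive (Y h))))
                (Elim-zeroʳ el X¹h))

  elim⇐ : ∀ {Z} → Elim O (- X) Y g Z → Elim O (- Y¹) X¹ e Z
  elim⇐ {Z} el@(cZ , Zg , _) = Elim-comm
    (Elim-unique hr (proj₁ X¹∘Y¹-rank) (proj₁ cX¹) (L1 (proj₁ cY¹)) sep-e
      (λ q → proj₁ (z-∘⁻ X¹ Y¹ q)) (λ q → z-neg {X = Y¹} (proj₂ (z-∘⁻ X¹ Y¹ q)))
      cZ Ze X¹∘Y¹⊆Z X¹h (negS-≢𝟘 Y¹h≢𝟘) Zh≢Y¹h)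
    where
    sep-e : sep X¹ (- Y¹) e
    sep-e = (λ X¹e≡𝟘 → Ce≢𝟘 (trans (sym X¹e) X¹e≡𝟘))
          , trans (trans X¹e (sym Y¹e)) (sym (negS-involutive (Y¹ e)))
    Ze : Z e ≡ 𝟘
    Ze = Elim-zero el (z-neg {X = X} Xe) Ye
    X¹∘Y¹⊆Z : z (X¹ ∘ Y¹) ⊆ z Z
    X¹∘Y¹⊆Z = covering (proj₂ X¹∘Y¹-rank) (proj₁ F-rank) (L2 (proj₁ cX¹) (proj₁ cY¹)) F⊆X¹∘Y¹
                (proj₁ cZ) (λ Fx → let (_ , Xx , Yx) = F-zeros Fx in
                                     Elim-zero el (z-neg {X = X} Xx) Yx)
                (z-∘⁺ {X = X¹} {Y¹} X¹g Y¹g) Zg g∉F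
    Zh≢Y¹h : Z h ≢ negS (negS (Y¹ h))
    Zh≢Y¹h rewrite negS-involutive (Y¹ h) | Y¹h = ≢negS Yh≢𝟘 (Elim-zeroˡ el (z-neg {X = X} Xh))

lemma4p5 : ∀ {n} (O : OrientedMatroid n) (r : ℕ) → HasRank O r → 3 ≤ r →
    (g f : Fin n) → Program O g f →
    (C X Y : SignVec n) →
    Comodular O r C X → Comodular O r C Y → Comodular O r X Y →
    FlatRank O (z (C ∘ (X ∘ Y))) (r ∸ 3) →
    C g ≡ ⊕ → X g ≡ ⊕ → Y g ≡ ⊕ →
    (e : Fin n) → C e ≢ 𝟘 → (X ∘ Y) e ≡ 𝟘 →
    (X¹ Y¹ : SignVec n) → Elim O (- X) C g X¹ → Elim O (- Y) C g Y¹ →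
    FlatRank O (z (X¹ ∘ Y¹)) (r ∸ 2) ×
    (Arrow O X Y g f ⇔ Arrow O Y¹ X¹ e f) ×
    (Arrow O Y¹ X¹ e f ⇔ Arrow O (- X¹) (- Y¹) e f)
lemma4p5 O _ hr (s≤s (s≤s (s≤s _))) g f _ C X Y
  ((LC , _) , (LX , _) , _ , _ , C∘X-chain , _) (_ , (LY , _) , _ , _ , C∘Y-chain , _)
  (_ , _ , _ , _ , X∘Y-rank) F-rank Cg Xg Yg e Ce≢𝟘 XYe X¹ Y¹ elimX elimY =
  X¹∘Y¹-rank , Arrow-cong (λ _ → mk⇔ elim⇐ elim⇒) , Arrow-neg
  where
  open OrientedMatroidProperties O
  open ComodularTriple O hr LC LX LY C∘X-chain C∘Y-chain X∘Y-rank F-rank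
                       Cg Xg Yg Ce≢𝟘 XYe elimX elimY
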